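{- For every $d\in\mathbb{N}$, $n\in\mathbb{N}_{\ge1}$ and $x\in\mathbb{R}\setminus\{0\}$, $$\sum_{k=0}^{n-1}\sum_{i=1}^{s_k}q_i(k)^dx^{q_i(k)}=\sum_{i=1}^{s_n}2^{q_i(n)-1}T(d,q_i(n),x)+\sum_{i=1}^{s_n}q_i(n)^dx^{q_i(n)}\big(n-M_i(n)\big).$$
   Context: For $k\in\mathbb{N}_{\ge1}$ write its binary decomposition $k=\sum_{j=1}^{s_k}2^{q_j(k)}$ with $0\le q_1(k)<\cdots<q_{s_k}(k)$; $s_0=0$ (so the inner sum is empty for $k=0$). For $1\le i\le s_n$, $M_i(n)=\sum_{j=i}^{s_n}2^{q_j(n)}$. For $d,N\in\mathbb{N}$ and $x\neq0$, $T(d,N,x)=\sum_{j=0}^{N-1}j^dx^j$. Convention $0^0=1$. -}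

module Defs where

open import Data.Nat using (ℕ; zero; suc)
import Data.Nat as ℕ
open import Data.Nat.DivMod using (_/_; _%_)
open import Data.Bool using (if_then_else_)
open import Data.Nat using (_≡ᵇ_)
open import Data.List using (List; []; _∷_; map; foldr; length; drop; lookup; allFin; upTo)
open import Data.Fin using (Fin; toℕ)
open import Level using (Level)
open import Algebra.Bundles using (CommutativeRing)
import Algebra.Bundles
import Algebra.Definitions.RawSemiring as RS

-- binary exponents of k, ascending: binDigits k = [q_1(k), ..., q_{s_k}(k)]
-- digitsAux fuel offset k : exponents (shifted by offset) of the 1-bits of k
digitsAux : ℕ → ℕ → ℕ → List ℕ
digitsAux zero    o k = []
digitsAux (suc f) o k =
  if (k % 2) ≡ᵇ 1 then o ∷ digitsAux f (suc o) (k / 2)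
                  else digitsAux f (suc o) (k / 2)

-- fuel k suffices (k has at most k binary digits); binDigits 0 = []
binDigits : ℕ → List ℕ
binDigits k = digitsAux k 0 k

s : ℕ → ℕ
s k = length (binDigits k)

-- q_{i+1}(k) for 0-indexed i : Fin s_k
q : (k : ℕ) → Fin (s k) → ℕ
q k i = lookup (binDigits k) i

-- M_{i+1}(n) = Σ_{j=i+1}^{s_n} 2^{q_j(n)} for 0-indexed i
M : (n : ℕ) → Fin (s n) → ℕ
M n i = foldr ℕ._+_ 0 (map (2 ℕ.^_) (drop (toℕ i) (binDigits n)))

module _ {c ℓ : Level} (R : CommutativeRing c ℓ) where
  open CommutativeRing R
  open RS (Algebra.Bundles.Semiring.rawSemiring semiring) using (_×_) renaming (_^_ to _^ᴿ_)

  ΣR : List Carrier → Carrier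
  ΣR = foldr _+_ 0#

  ⟦_⟧ : ℕ → Carrier
  ⟦ m ⟧ = m × 1#

  -- T(d,N,x) = Σ_{j=0}^{N-1} j^d x^j   (j^d computed in ℕ, so 0^0 = 1)
  T : ℕ → ℕ → Carrier → Carrier
  T d N x = ΣR (map (λ j → ⟦ j ℕ.^ d ⟧ * (x ^ᴿ j)) (upTo N))

  LHS : ℕ → ℕ → Carrier → Carrier
  LHS d n x = ΣR (map (λ k → ΣR (map (λ i → ⟦ q k i ℕ.^ d ⟧ * (x ^ᴿ q k i)) (allFin (s k)))) (upTo n))

  -- RHS: Σ_i 2^{q_i(n)-1} T(d,q_i(n),x) + Σ_i q_i(n)^d x^{q_i(n)} (n - M_i(n))
  -- 2^{q-1} is taken as 2^(q ∸ 1); for q = 0 the factor T(d,0,x) = 0 anyway.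
  RHS : ℕ → ℕ → Carrier → Carrier
  RHS d n x =
    ΣR (map (λ i → ⟦ 2 ℕ.^ (q n i ℕ.∸ 1) ⟧ * T d (q n i) x) (allFin (s n)))
    + ΣR (map (λ i → (⟦ q n i ℕ.^ d ⟧ * (x ^ᴿ q n i)) * (⟦ n ⟧ - ⟦ M n i ⟧)) (allFin (s n)))

{-# OPTIONS --safe #-}
module Submission where

open import Defs
open import Level using (Level)
open import Data.Nat using (ℕ; suc)
open import Algebra.Bundles using (CommutativeRing)
open import Relation.Nullary using (¬_)

-- Nothing about j ↦ j^d x^j is used: for every f : ℕ → R, with D f k = Σ_{q ∈ bits k} f q,
--   Σ_{k<n} D f k = Σ_i 2^{q_i-1} Σ_{j<q_i} f j + Σ_i f q_i (n - M_i(n)),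
-- and this is proved by binary induction on n. Doubling shifts every binary digit up by one and
-- 2m+1 has digits 0 ∷ bits (2m), so pairing k < 2m as 2k, 2k+1 gives
-- Σ_{k<2m} D f k = m f 0 + 2 Σ_{k<m} D (f ∘ suc) k; the right-hand side obeys the same recursion
-- because the digits of m have value m, and the odd step adds the single term D f (2m).

open import Data.Nat using (zero)
import Data.Nat as ℕ
import Data.Nat.Properties as ℕ
open import Data.Fin using (toℕ)
open import Data.List using (List; []; _∷_; map; foldr; lookup; drop; allFin; tabulate; length; upTo; applyUpTo)
open import Data.List.Properties using (map-tabulate; tabulate-lookup; map-applyUpTo; map-∘; map-cong)
open import Function using (id; _∘_)
open import Algebra.Bundles using (CommutativeSemiring)
import Algebra.Definitions.RawSemiring as RawSemiringDefinitions
open import Relation.Binary.PropositionalEquality as ≡ using (_≡_)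

module BinaryDigits where
  open import Data.Nat
  open import Data.Nat.Properties
  open import Data.Nat.DivMod using (m*n%n≡0; m*n/n≡m; [m+kn]%n≡m%n; +-distrib-/-∣ʳ; m/n<m)
  open import Data.Nat.Divisibility using (n∣m*n)
  open import Data.Nat.Induction using (<-rec)
  open import Data.Nat.ListAction using (sum)
  open import Data.Nat.Tactic.RingSolver using (solve-∀)
  open import Data.Bool using (true; false)
  open import Relation.Binary.PropositionalEquality

  private
    m+m≡m*2 : ∀ m → m + m ≡ m * 2
    m+m≡m*2 m = sym (trans (*-suc m 1) (cong (m +_) (*-identityʳ m)))

    [m+m]%2≡0 : ∀ m → (m + m) % 2 ≡ 0
    [m+m]%2≡0 m rewrite m+m≡m*2 m = m*n%n≡0 m 2

    [m+m]/2≡m : ∀ m → (m + m) / 2 ≡ m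
    [m+m]/2≡m m rewrite m+m≡m*2 m = m*n/n≡m m 2

    [1+m+m]%2≡1 : ∀ m → suc (m + m) % 2 ≡ 1
    [1+m+m]%2≡1 m rewrite m+m≡m*2 m = [m+kn]%n≡m%n 1 m 2

    [1+m+m]/2≡m : ∀ m → suc (m + m) / 2 ≡ m
    [1+m+m]/2≡m m rewrite m+m≡m*2 m = trans (+-distrib-/-∣ʳ 1 {d = 2} (n∣m*n m)) (m*n/n≡m m 2)

    half≤ : ∀ {k f} → k ≤ suc f → k / 2 ≤ f
    half≤ {zero}  _   = z≤n
    half≤ {suc k} k≤f = ≤-pred (<-≤-trans (m/n<m (suc k) 2 (s≤s (s≤s z≤n))) k≤f)

  digitsAux-even : ∀ f o k → k % 2 ≡ 0 → digitsAux (suc f) o k ≡ digitsAux f (suc o) (k / 2)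
  digitsAux-even f o k k%2≡0 rewrite k%2≡0 = refl

  digitsAux-odd : ∀ f o k → k % 2 ≡ 1 → digitsAux (suc f) o k ≡ o ∷ digitsAux f (suc o) (k / 2)
  digitsAux-odd f o k k%2≡1 rewrite k%2≡1 = refl

  digitsAux-shift : ∀ f o k → digitsAux f (suc o) k ≡ map suc (digitsAux f o k)
  digitsAux-shift zero    o k = refl
  digitsAux-shift (suc f) o k with (k % 2) ≡ᵇ 1
  ... | true  = cong (suc o ∷_) (digitsAux-shift f (suc o) (k / 2))
  ... | false = digitsAux-shift f (suc o) (k / 2)

  digitsAux-zero : ∀ f o → digitsAux f o 0 ≡ []
  digitsAux-zero zero    o = refl
  digitsAux-zero (suc f) o = digitsAux-zero f (suc o)

  digitsAux-fuel : ∀ {f g} o k → k ≤ f → k ≤ g → digitsAux f o k ≡ digitsAux g o k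
  digitsAux-fuel {zero}  {g}     o .0 z≤n _   = sym (digitsAux-zero g o)
  digitsAux-fuel {suc f} {zero}  o .0 _   z≤n = digitsAux-zero (suc f) o
  digitsAux-fuel {suc f} {suc g} o k  k≤f k≤g with (k % 2) ≡ᵇ 1
  ... | true  = cong (o ∷_) (digitsAux-fuel (suc o) (k / 2) (half≤ k≤f) (half≤ k≤g))
  ... | false = digitsAux-fuel (suc o) (k / 2) (half≤ k≤f) (half≤ k≤g)

  private
    binDigits-double′ : ∀ m → binDigits (m + m) ≡ digitsAux (m + m) 1 m
    binDigits-double′ m = begin
      binDigits (m + m)                  ≡⟨ digitsAux-fuel 0 (m + m) ≤-refl (n≤1+n (m + m)) ⟩
      digitsAux (suc (m + m)) 0 (m + m)  ≡⟨ digitsAux-even (m + m) 0 (m + m) ([m+m]%2≡0 m) ⟩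
      digitsAux (m + m) 1 ((m + m) / 2)  ≡⟨ cong (digitsAux (m + m) 1) ([m+m]/2≡m m) ⟩
      digitsAux (m + m) 1 m              ∎
      where open ≡-Reasoning

  binDigits-double : ∀ m → binDigits (m + m) ≡ map suc (binDigits m)
  binDigits-double m = begin
    binDigits (m + m)      ≡⟨ binDigits-double′ m ⟩
    digitsAux (m + m) 1 m  ≡⟨ digitsAux-fuel 1 m (m≤n+m m m) ≤-refl ⟩
    digitsAux m 1 m        ≡⟨ digitsAux-shift m 0 m ⟩
    map suc (binDigits m)  ∎
    where open ≡-Reasoning

  binDigits-double+1 : ∀ m → binDigits (suc (m + m)) ≡ 0 ∷ binDigits (m + m)
  binDigits-double+1 m = begin
    binDigits (suc (m + m))                    ≡⟨ digitsAux-odd (m + m) 0 (suc (m + m)) ([1+m+m]%2≡1 m) ⟩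
    0 ∷ digitsAux (m + m) 1 (suc (m + m) / 2)  ≡⟨ cong (λ k → 0 ∷ digitsAux (m + m) 1 k) ([1+m+m]/2≡m m) ⟩
    0 ∷ digitsAux (m + m) 1 m                  ≡⟨ cong (0 ∷_) (binDigits-double′ m) ⟨
    0 ∷ binDigits (m + m)                      ∎
    where open ≡-Reasoning

  data ParityView : ℕ → Set where
    even : ∀ m → ParityView (m + m)
    odd  : ∀ m → ParityView (suc (m + m))

  parityView : ∀ n → ParityView n
  parityView zero    = even 0
  parityView (suc n) with parityView n
  ... | even m = odd m
  ... | odd m  = subst ParityView (cong suc (+-suc m m)) (even (suc m))

  binary-induction : ∀ {ℓ} (P : ℕ → Set ℓ) → P 0 →
                     (∀ m → P m → P (m + m)) → (∀ m → P m → P (suc (m + m))) → ∀ n → P n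
  binary-induction P P0 P-double P-double+1 = <-rec P step
    where
    step : ∀ n → (∀ {m} → m < n → P m) → P n
    step n rec with parityView n
    ... | even zero    = P0
    ... | even (suc m) = P-double (suc m) (rec (m<n+m (suc m) (s≤s z≤n)))
    ... | odd m        = P-double+1 m (rec (s≤s (m≤m+n m m)))

  value : List ℕ → ℕ
  value L = sum (map (2 ^_) L)

  value-map-suc : ∀ L → value (map suc L) ≡ value L + value L
  value-map-suc []      = refl
  value-map-suc (q ∷ L) rewrite value-map-suc L = lemma (2 ^ q) (value L)
    where
    lemma : ∀ a b → a + (a + 0) + (b + b) ≡ a + b + (a + b)
    lemma = solve-∀

  value-binDigits : ∀ n → value (binDigits n) ≡ n
  value-binDigits = binary-induction (λ n → value (binDigits n) ≡ n) refl double double+1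
    where
    double : ∀ m → value (binDigits m) ≡ m → value (binDigits (m + m)) ≡ m + m
    double m ih = trans (cong value (binDigits-double m))
                        (trans (value-map-suc (binDigits m)) (cong₂ _+_ ih ih))

    double+1 : ∀ m → value (binDigits m) ≡ m → value (binDigits (suc (m + m))) ≡ suc (m + m)
    double+1 m ih = trans (cong value (binDigits-double+1 m)) (cong suc (double m ih))

open BinaryDigits using (binDigits-double; binDigits-double+1; binary-induction; value; value-map-suc; value-binDigits)

module _ {a b} {A : Set a} {B : Set b} where

  mapSuffixes : (A → List A → B) → List A → List B
  mapSuffixes h []      = []
  mapSuffixes h (x ∷ L) = h x (x ∷ L) ∷ mapSuffixes h L

  map-lookup-allFin : ∀ (g : A → B) L → map (g ∘ lookup L) (allFin (length L)) ≡ map g L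
  map-lookup-allFin g L = ≡.trans (map-tabulate id (g ∘ lookup L))
    (≡.trans (≡.sym (map-tabulate (lookup L) g)) (≡.cong (map g) (tabulate-lookup L)))

  map-lookup-drop-allFin : ∀ (h : A → List A → B) L →
    map (λ i → h (lookup L i) (drop (toℕ i) L)) (allFin (length L)) ≡ mapSuffixes h L
  map-lookup-drop-allFin h L = ≡.trans (map-tabulate id _) (tabulate-suffixes L)
    where
    tabulate-suffixes : ∀ L → tabulate (λ i → h (lookup L i) (drop (toℕ i) L)) ≡ mapSuffixes h L
    tabulate-suffixes []      = ≡.refl
    tabulate-suffixes (x ∷ L) = ≡.cong (h x (x ∷ L) ∷_) (tabulate-suffixes L)

module FiniteSums {c ℓ} (S : CommutativeSemiring c ℓ) where
  open CommutativeSemiring S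
  open import Algebra.Properties.Semiring.Mult semiring using (_×_)
  open import Algebra.Solver.Ring.NaturalCoefficients.Default S using (solve; _:+_; _:=_)
  open import Relation.Binary.Reasoning.Setoid setoid

  sumBelow : ℕ → (ℕ → Carrier) → Carrier
  sumBelow zero    h = 0#
  sumBelow (suc n) h = sumBelow n h + h n

  sumBelow-cong : ∀ n {g h : ℕ → Carrier} → (∀ k → g k ≈ h k) → sumBelow n g ≈ sumBelow n h
  sumBelow-cong zero    g≈h = refl
  sumBelow-cong (suc n) g≈h = +-cong (sumBelow-cong n g≈h) (g≈h n)

  sumBelow-suc : ∀ n h → sumBelow (suc n) h ≈ h 0 + sumBelow n (h ∘ suc)
  sumBelow-suc zero    h = +-comm 0# (h 0)
  sumBelow-suc (suc n) h = begin
    sumBelow (suc n) h + h (suc n)            ≈⟨ +-congʳ (sumBelow-suc n h) ⟩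
    (h 0 + sumBelow n (h ∘ suc)) + h (suc n)  ≈⟨ +-assoc _ _ _ ⟩
    h 0 + (sumBelow n (h ∘ suc) + h (suc n))  ∎

  sumBelow-+ : ∀ n g h → sumBelow n (λ k → g k + h k) ≈ sumBelow n g + sumBelow n h
  sumBelow-+ zero    g h = sym (+-identityʳ 0#)
  sumBelow-+ (suc n) g h = trans (+-congʳ (sumBelow-+ n g h)) (interchange _ _ _ _)
    where
    interchange : ∀ x y z w → (x + y) + (z + w) ≈ (x + z) + (y + w)
    interchange = solve 4 (λ x y z w → (x :+ y) :+ (z :+ w) := (x :+ z) :+ (y :+ w)) refl

  sumBelow-const : ∀ n x → sumBelow n (λ _ → x) ≈ (n × 1#) * x
  sumBelow-const zero    x = sym (zeroˡ x)
  sumBelow-const (suc n) x = begin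
    sumBelow n (λ _ → x) + x   ≈⟨ +-cong (sumBelow-const n x) (sym (*-identityˡ x)) ⟩
    (n × 1#) * x + 1# * x      ≈⟨ +-comm _ _ ⟩
    1# * x + (n × 1#) * x      ≈⟨ distribʳ x 1# (n × 1#) ⟨
    (suc n × 1#) * x           ∎

  sumBelow-pairs : ∀ m h → sumBelow (m ℕ.+ m) h ≈ sumBelow m (λ k → h (k ℕ.+ k) + h (suc (k ℕ.+ k)))
  sumBelow-pairs zero    h = refl
  sumBelow-pairs (suc m) h = begin
    sumBelow (suc m ℕ.+ suc m) h                             ≡⟨ ≡.cong (λ k → sumBelow (suc k) h) (ℕ.+-suc m m) ⟩
    (sumBelow (m ℕ.+ m) h + h (m ℕ.+ m)) + h (suc (m ℕ.+ m)) ≈⟨ +-assoc _ _ _ ⟩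
    sumBelow (m ℕ.+ m) h + (h (m ℕ.+ m) + h (suc (m ℕ.+ m))) ≈⟨ +-congʳ (sumBelow-pairs m h) ⟩
    sumBelow (suc m) (λ k → h (k ℕ.+ k) + h (suc (k ℕ.+ k))) ∎

  foldr-map-cong : ∀ {a} {A : Set a} (L : List A) {g h : A → Carrier} → (∀ x → g x ≈ h x) →
                   foldr _+_ 0# (map g L) ≈ foldr _+_ 0# (map h L)
  foldr-map-cong []      g≈h = refl
  foldr-map-cong (x ∷ L) g≈h = +-cong (g≈h x) (foldr-map-cong L g≈h)

  foldr-map-upTo : ∀ n h → foldr _+_ 0# (map h (upTo n)) ≈ sumBelow n h
  foldr-map-upTo n h = trans (reflexive (≡.cong (foldr _+_ 0#) (map-applyUpTo id h n))) (applyUpTo-sum n h)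
    where
    applyUpTo-sum : ∀ n h → foldr _+_ 0# (applyUpTo h n) ≈ sumBelow n h
    applyUpTo-sum zero    h = refl
    applyUpTo-sum (suc n) h = trans (+-congˡ (applyUpTo-sum n (h ∘ suc))) (sym (sumBelow-suc n h))

module _ {c ℓ} (R : CommutativeRing c ℓ) where
  open CommutativeRing R
  open FiniteSums commutativeSemiring
  open RawSemiringDefinitions (CommutativeSemiring.rawSemiring commutativeSemiring) using () renaming (_^_ to _^ᴿ_)
  open import Algebra.Properties.Semiring.Mult semiring using (×-homo-+)
  open import Algebra.Properties.AbelianGroup +-abelianGroup using (⁻¹-∙-comm)
  open import Algebra.Solver.Ring.NaturalCoefficients.Default commutativeSemiring using (solve; _:+_; _:*_; _:=_; con)
  open import Relation.Binary.Reasoning.Setoid setoid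

  ⟪_⟫ : ℕ → Carrier
  ⟪_⟫ = ⟦_⟧ R

  ⟪⟫-homo-+ : ∀ m n → ⟪ m ℕ.+ n ⟫ ≈ ⟪ m ⟫ + ⟪ n ⟫
  ⟪⟫-homo-+ = ×-homo-+ 1#

  ⟪⟫-double : ∀ n → ⟪ 2 ℕ.* n ⟫ ≈ ⟪ n ⟫ + ⟪ n ⟫
  ⟪⟫-double n = trans (⟪⟫-homo-+ n (n ℕ.+ 0)) (+-congˡ (reflexive (≡.cong ⟪_⟫ (ℕ.+-identityʳ n))))

  digitSum : (ℕ → Carrier) → ℕ → Carrier
  digitSum f k = ΣR R (map f (binDigits k))

  digitSum-double : ∀ f m → digitSum f (m ℕ.+ m) ≡ digitSum (f ∘ suc) m
  digitSum-double f m = ≡.trans (≡.cong (ΣR R ∘ map f) (binDigits-double m))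
                                (≡.cong (ΣR R) (≡.sym (map-∘ (binDigits m))))

  digitSum-double+1 : ∀ f m → digitSum f (suc (m ℕ.+ m)) ≡ f 0 + digitSum f (m ℕ.+ m)
  digitSum-double+1 f m = ≡.cong (ΣR R ∘ map f) (binDigits-double+1 m)

  sumBelow-digitSum-double : ∀ f m → sumBelow (m ℕ.+ m) (digitSum f) ≈
    ⟪ m ⟫ * f 0 + (sumBelow m (digitSum (f ∘ suc)) + sumBelow m (digitSum (f ∘ suc)))
  sumBelow-digitSum-double f m = begin
    sumBelow (m ℕ.+ m) (digitSum f)                                      ≈⟨ sumBelow-pairs m (digitSum f) ⟩
    sumBelow m (λ k → digitSum f (k ℕ.+ k) + digitSum f (suc (k ℕ.+ k))) ≈⟨ sumBelow-cong m pair ⟩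
    sumBelow m (λ k → f 0 + (g k + g k))                                 ≈⟨ sumBelow-+ m _ _ ⟩
    sumBelow m (λ _ → f 0) + sumBelow m (λ k → g k + g k)                ≈⟨ +-cong (sumBelow-const m (f 0)) (sumBelow-+ m g g) ⟩
    ⟪ m ⟫ * f 0 + (sumBelow m g + sumBelow m g)                          ∎
    where
    g : ℕ → Carrier
    g = digitSum (f ∘ suc)
    pair : ∀ k → digitSum f (k ℕ.+ k) + digitSum f (suc (k ℕ.+ k)) ≈ f 0 + (g k + g k)
    pair k rewrite digitSum-double+1 f k | digitSum-double f k = shuffle (g k) (f 0)
      where
      shuffle : ∀ x y → x + (y + x) ≈ y + (x + x)
      shuffle = solve 2 (λ x y → x :+ (y :+ x) := y :+ (x :+ x)) refl

  blockSum : (ℕ → Carrier) → List ℕ → Carrier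
  blockSum f L = ΣR R (map (λ q → ⟪ 2 ℕ.^ (q ℕ.∸ 1) ⟫ * sumBelow q f) L)

  -- The suffix of the digits starting at q_i has value M_i(n).
  offsetSum : (ℕ → Carrier) → List ℕ → Carrier → Carrier
  offsetSum f L N = ΣR R (mapSuffixes (λ q tl → f q * (N - ⟪ value tl ⟫)) L)

  closedForm : (ℕ → Carrier) → ℕ → Carrier
  closedForm f n = blockSum f (binDigits n) + offsetSum f (binDigits n) ⟪ n ⟫

  power-halve : ∀ q g → ⟪ 2 ℕ.^ q ⟫ * sumBelow q g ≈
    ⟪ 2 ℕ.^ (q ℕ.∸ 1) ⟫ * sumBelow q g + ⟪ 2 ℕ.^ (q ℕ.∸ 1) ⟫ * sumBelow q g
  power-halve zero    g = solve 1 (λ a → a :* con 0 := a :* con 0 :+ a :* con 0) refl ⟪ 1 ⟫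
  power-halve (suc p) g = begin
    ⟪ 2 ℕ.* 2 ℕ.^ p ⟫ * sumBelow (suc p) g                            ≈⟨ *-congʳ (⟪⟫-double (2 ℕ.^ p)) ⟩
    (⟪ 2 ℕ.^ p ⟫ + ⟪ 2 ℕ.^ p ⟫) * sumBelow (suc p) g                   ≈⟨ distribʳ _ _ _ ⟩
    ⟪ 2 ℕ.^ p ⟫ * sumBelow (suc p) g + ⟪ 2 ℕ.^ p ⟫ * sumBelow (suc p) g ∎

  blockSum-map-suc : ∀ f L → blockSum f (map suc L) ≈ ⟪ value L ⟫ * f 0 + (blockSum (f ∘ suc) L + blockSum (f ∘ suc) L)
  blockSum-map-suc f []      = solve 1 (λ x → con 0 := con 0 :* x :+ (con 0 :+ con 0)) refl (f 0)
  blockSum-map-suc f (q ∷ L) = begin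
    ⟪ 2 ℕ.^ q ⟫ * sumBelow (suc q) f + blockSum f (map suc L)      ≈⟨ +-cong block (blockSum-map-suc f L) ⟩
    (⟪ 2 ℕ.^ q ⟫ * f 0 + (t + t)) + (⟪ value L ⟫ * f 0 + (B + B)) ≈⟨ regroup ⟪ 2 ℕ.^ q ⟫ ⟪ value L ⟫ (f 0) t B ⟩
    (⟪ 2 ℕ.^ q ⟫ + ⟪ value L ⟫) * f 0 + ((t + B) + (t + B))       ≈⟨ +-congʳ (*-congʳ (⟪⟫-homo-+ (2 ℕ.^ q) (value L))) ⟨
    ⟪ value (q ∷ L) ⟫ * f 0 + ((t + B) + (t + B))                 ∎
    where
    t B : Carrier
    t = ⟪ 2 ℕ.^ (q ℕ.∸ 1) ⟫ * sumBelow q (f ∘ suc)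
    B = blockSum (f ∘ suc) L
    block : ⟪ 2 ℕ.^ q ⟫ * sumBelow (suc q) f ≈ ⟪ 2 ℕ.^ q ⟫ * f 0 + (t + t)
    block = trans (*-congˡ (sumBelow-suc q f)) (trans (distribˡ _ _ _) (+-congˡ (power-halve q (f ∘ suc))))
    regroup : ∀ a b x t B → (a * x + (t + t)) + (b * x + (B + B)) ≈ (a + b) * x + ((t + B) + (t + B))
    regroup = solve 5 (λ a b x t B → (a :* x :+ (t :+ t)) :+ (b :* x :+ (B :+ B)) := (a :+ b) :* x :+ ((t :+ B) :+ (t :+ B))) refl

  offsetSum-+ : ∀ f L a N → offsetSum f L (a + N) ≈ a * ΣR R (map f L) + offsetSum f L N
  offsetSum-+ f []      a N = solve 1 (λ a → con 0 := a :* con 0 :+ con 0) refl a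
  offsetSum-+ f (q ∷ L) a N = begin
    f q * ((a + N) - v) + offsetSum f L (a + N)                ≈⟨ +-cong (*-congˡ (+-assoc a N (- v))) (offsetSum-+ f L a N) ⟩
    f q * (a + (N - v)) + (a * ΣR R (map f L) + offsetSum f L N) ≈⟨ regroup (f q) a (N - v) _ _ ⟩
    a * (f q + ΣR R (map f L)) + (f q * (N - v) + offsetSum f L N) ∎
    where
    v : Carrier
    v = ⟪ value (q ∷ L) ⟫
    regroup : ∀ y a d Z O → y * (a + d) + (a * Z + O) ≈ a * (y + Z) + (y * d + O)
    regroup = solve 5 (λ y a d Z O → y :* (a :+ d) :+ (a :* Z :+ O) := a :* (y :+ Z) :+ (y :* d :+ O)) refl

  offsetSum-map-suc : ∀ f L n → offsetSum f (map suc L) ⟪ n ℕ.+ n ⟫ ≈ offsetSum (f ∘ suc) L ⟪ n ⟫ + offsetSum (f ∘ suc) L ⟪ n ⟫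
  offsetSum-map-suc f []      n = sym (+-identityʳ 0#)
  offsetSum-map-suc f (q ∷ L) n = begin
    f (suc q) * (⟪ n ℕ.+ n ⟫ - ⟪ value (map suc (q ∷ L)) ⟫) + offsetSum f (map suc L) ⟪ n ℕ.+ n ⟫
      ≈⟨ +-cong (*-congˡ difference) (offsetSum-map-suc f L n) ⟩
    f (suc q) * (d + d) + (O + O)  ≈⟨ solve 3 (λ y d O → y :* (d :+ d) :+ (O :+ O) := (y :* d :+ O) :+ (y :* d :+ O)) refl (f (suc q)) d O ⟩
    (f (suc q) * d + O) + (f (suc q) * d + O) ∎
    where
    w d O : Carrier
    w = ⟪ value (q ∷ L) ⟫
    d = ⟪ n ⟫ - w
    O = offsetSum (f ∘ suc) L ⟪ n ⟫
    difference : ⟪ n ℕ.+ n ⟫ - ⟪ value (map suc (q ∷ L)) ⟫ ≈ d + d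
    difference = begin
      ⟪ n ℕ.+ n ⟫ - ⟪ value (map suc (q ∷ L)) ⟫ ≡⟨ ≡.cong (λ k → ⟪ n ℕ.+ n ⟫ - ⟪ k ⟫) (value-map-suc (q ∷ L)) ⟩
      ⟪ n ℕ.+ n ⟫ - ⟪ value (q ∷ L) ℕ.+ value (q ∷ L) ⟫ ≈⟨ +-cong (⟪⟫-homo-+ n n) (-‿cong (⟪⟫-homo-+ (value (q ∷ L)) (value (q ∷ L)))) ⟩
      (⟪ n ⟫ + ⟪ n ⟫) - (w + w)                          ≈⟨ +-congˡ (⁻¹-∙-comm w w) ⟨
      (⟪ n ⟫ + ⟪ n ⟫) + (- w + - w)                      ≈⟨ solve 2 (λ N v → (N :+ N) :+ (v :+ v) := (N :+ v) :+ (N :+ v)) refl ⟪ n ⟫ (- w) ⟩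
      d + d                                               ∎

  offsetSum-exhausted : ∀ f q L {N} → ⟪ value (q ∷ L) ⟫ ≈ N → offsetSum f (q ∷ L) N ≈ offsetSum f L N
  offsetSum-exhausted f q L {N} v≈N = begin
    f q * (N - ⟪ value (q ∷ L) ⟫) + offsetSum f L N ≈⟨ +-congʳ (*-congˡ (+-congˡ (-‿cong v≈N))) ⟩
    f q * (N - N) + offsetSum f L N                 ≈⟨ +-congʳ (trans (*-congˡ (-‿inverseʳ N)) (zeroʳ (f q))) ⟩
    0# + offsetSum f L N                            ≈⟨ +-identityˡ _ ⟩
    offsetSum f L N                                 ∎

  closedForm-double : ∀ f m → closedForm f (m ℕ.+ m) ≈ ⟪ m ⟫ * f 0 + (closedForm (f ∘ suc) m + closedForm (f ∘ suc) m)
  closedForm-double f m = begin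
    blockSum f (binDigits (m ℕ.+ m)) + offsetSum f (binDigits (m ℕ.+ m)) ⟪ m ℕ.+ m ⟫
      ≡⟨ ≡.cong (λ L → blockSum f L + offsetSum f L ⟪ m ℕ.+ m ⟫) (binDigits-double m) ⟩
    blockSum f (map suc D) + offsetSum f (map suc D) ⟪ m ℕ.+ m ⟫
      ≈⟨ +-cong (blockSum-map-suc f D) (offsetSum-map-suc f D m) ⟩
    (⟪ value D ⟫ * f 0 + (B + B)) + (O + O)
      ≡⟨ ≡.cong (λ k → (⟪ k ⟫ * f 0 + (B + B)) + (O + O)) (value-binDigits m) ⟩
    (⟪ m ⟫ * f 0 + (B + B)) + (O + O)
      ≈⟨ solve 4 (λ a B O x → (a :* x :+ (B :+ B)) :+ (O :+ O) := a :* x :+ ((B :+ O) :+ (B :+ O))) refl ⟪ m ⟫ B O (f 0) ⟩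
    ⟪ m ⟫ * f 0 + ((B + O) + (B + O)) ∎
    where
    D : List ℕ
    D = binDigits m
    B O : Carrier
    B = blockSum (f ∘ suc) D
    O = offsetSum (f ∘ suc) D ⟪ m ⟫

  closedForm-double+1 : ∀ f m → closedForm f (suc (m ℕ.+ m)) ≈ closedForm f (m ℕ.+ m) + digitSum f (m ℕ.+ m)
  closedForm-double+1 f m = begin
    blockSum f (binDigits n) + offsetSum f (binDigits n) ⟪ n ⟫
      ≡⟨ ≡.cong (λ L → blockSum f L + offsetSum f L ⟪ n ⟫) (binDigits-double+1 m) ⟩
    (⟪ 1 ⟫ * 0# + blockSum f D) + offsetSum f (0 ∷ D) ⟪ n ⟫
      ≈⟨ +-cong (trans (+-congʳ (zeroʳ ⟪ 1 ⟫)) (+-identityˡ _)) (offsetSum-exhausted f 0 D top) ⟩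
    blockSum f D + offsetSum f D (1# + ⟪ m ℕ.+ m ⟫)
      ≈⟨ +-congˡ (offsetSum-+ f D 1# ⟪ m ℕ.+ m ⟫) ⟩
    blockSum f D + (1# * digitSum f (m ℕ.+ m) + offsetSum f D ⟪ m ℕ.+ m ⟫)
      ≈⟨ solve 3 (λ B S O → B :+ (con 1 :* S :+ O) := (B :+ O) :+ S) refl (blockSum f D) _ _ ⟩
    closedForm f (m ℕ.+ m) + digitSum f (m ℕ.+ m) ∎
    where
    n : ℕ
    n = suc (m ℕ.+ m)
    D : List ℕ
    D = binDigits (m ℕ.+ m)
    top : ⟪ value (0 ∷ D) ⟫ ≈ ⟪ n ⟫
    top = reflexive (≡.cong ⟪_⟫ (≡.trans (≡.cong value (≡.sym (binDigits-double+1 m))) (value-binDigits n)))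

  sumBelow-digitSum : ∀ n f → sumBelow n (digitSum f) ≈ closedForm f n
  sumBelow-digitSum = binary-induction (λ n → ∀ f → sumBelow n (digitSum f) ≈ closedForm f n)
    (λ f → sym (+-identityʳ 0#)) double double+1
    where
    double : ∀ m → (∀ f → sumBelow m (digitSum f) ≈ closedForm f m) →
             ∀ f → sumBelow (m ℕ.+ m) (digitSum f) ≈ closedForm f (m ℕ.+ m)
    double m ih f = begin
      sumBelow (m ℕ.+ m) (digitSum f)   ≈⟨ sumBelow-digitSum-double f m ⟩
      ⟪ m ⟫ * f 0 + (sumBelow m (digitSum (f ∘ suc)) + sumBelow m (digitSum (f ∘ suc)))
        ≈⟨ +-congˡ (+-cong (ih (f ∘ suc)) (ih (f ∘ suc))) ⟩
      ⟪ m ⟫ * f 0 + (closedForm (f ∘ suc) m + closedForm (f ∘ suc) m) ≈⟨ closedForm-double f m ⟨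
      closedForm f (m ℕ.+ m)             ∎

    double+1 : ∀ m → (∀ f → sumBelow m (digitSum f) ≈ closedForm f m) →
               ∀ f → sumBelow (suc (m ℕ.+ m)) (digitSum f) ≈ closedForm f (suc (m ℕ.+ m))
    double+1 m ih f = trans (+-congʳ (double m ih f)) (sym (closedForm-double+1 f m))

  weightedPower : ℕ → Carrier → ℕ → Carrier
  weightedPower d x j = ⟪ j ℕ.^ d ⟫ * x ^ᴿ j

  LHS≈sumBelow-digitSum : ∀ d n x → LHS R d n x ≈ sumBelow n (digitSum (weightedPower d x))
  LHS≈sumBelow-digitSum d n x = trans
    (reflexive (≡.cong (ΣR R) (map-cong (λ k → ≡.cong (ΣR R) (map-lookup-allFin F (binDigits k))) (upTo n))))
    (foldr-map-upTo n (digitSum F))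
    where
    F : ℕ → Carrier
    F = weightedPower d x

  RHS≈closedForm : ∀ d n x → RHS R d n x ≈ closedForm (weightedPower d x) n
  RHS≈closedForm d n x = +-cong
    (trans (reflexive (≡.cong (ΣR R) (map-lookup-allFin _ D)))
           (foldr-map-cong D (λ q → *-congˡ (foldr-map-upTo q F))))
    (reflexive (≡.cong (ΣR R) (map-lookup-drop-allFin _ D)))
    where
    D : List ℕ
    D = binDigits n
    F : ℕ → Carrier
    F = weightedPower d x

-- The identity holds for every n and every x.
lemma2 : ∀ {c ℓ : Level} (R : CommutativeRing c ℓ) (d n : ℕ) → 1 Data.Nat.≤ n →
           (x : CommutativeRing.Carrier R) → ¬ (CommutativeRing._≈_ R x (CommutativeRing.0# R)) →
           CommutativeRing._≈_ R (LHS R d n x) (RHS R d n x)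
lemma2 R d n _ x _ = begin
  LHS R d n x                     ≈⟨ LHS≈sumBelow-digitSum R d n x ⟩
  sumBelow n (digitSum R F)       ≈⟨ sumBelow-digitSum R n F ⟩
  closedForm R F n                ≈⟨ RHS≈closedForm R d n x ⟨
  RHS R d n x                     ∎
  where
  open CommutativeRing R using (Carrier; setoid; commutativeSemiring)
  open FiniteSums commutativeSemiring using (sumBelow)
  open import Relation.Binary.Reasoning.Setoid setoid
  F : ℕ → Carrier
  F = weightedPower R d x
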